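{- Let $f$ be a comparator network of order $n$ that is a selection network for parameter $k$, half encoded as $\phi(f)$. Assume exactly $k-1$ input variables are set to true, the other variables were initially undefined, and unit propagation has been performed (setting $y_1,\dots,y_{k-1}$ to true). If $\bar z_x=\langle z_1,\dots,z_m\rangle$ is a propagation path for an undefined input variable $x$, then $z_m$ is the variable $y_k$.
   Context: A comparator $c_{i,j}$ ($i<j$) puts the maximum of the entries at positions $i,j$ into position $i$ and the minimum into position $j$; a comparator network of order $n$ is a finite sequence of comparators. $f$ is a selection network for $k$ if for every input its output satisfies $y_1\ge\dots\ge y_k$ and $y_i\ge y_j$ for $i\le k<j$. Half encoding: position $i$ initially carries the boolean input variable $x_i$; a comparator $c_{i,j}$ with current variables $a$ (upper input, position $i$), $b$ (lower input, position $j$) introduces fresh output variables $c$ (position $i$), $d$ (position $j$) and the clauses $(\neg a\vee c)\wedge(\neg b\vee c)\wedge(\neg a\vee\neg b\vee d)$; outputs $y_1,\dots,y_n$ are the final variables of the positions; $\phi(f)$ is the conjunction of all clauses. Unit propagation (UP) repeatedly sets to true the only undefined literal of a clause whose other literals are false. A path is a sequence $\langle z_1,\dots,z_m\rangle$ of variables of $\phi(f)$ such that for every $1\le i<m$ there is a comparator with inputs $a,b$ and outputs $c,d$ with $z_i\in\{a,b\}$ and $z_{i+1}\in\{c,d\}$. For an undefined input variable $x$, a path $\bar z_x=\langle z_1,\dots,z_m\rangle$ ($m\ge1$) is a propagation path if $z_1=x$ and $\langle z_2,\dots,z_m\rangle$ is the sequence of variables that UP would set to true if we additionally set $z_1$ to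 true. -}

module Defs where

open import Data.Nat using (ℕ; zero; suc; _<_; _≤_; _∸_)
open import Data.Nat.Properties using (≤-trans)
open import Data.Fin as Fin using (Fin; toℕ; fromℕ<)
open import Data.Fin.Subset using (Subset; ∣_∣)
open import Data.Bool as Bool using (Bool; true; false; not; _∨_; _∧_; if_then_else_)
open import Data.Vec using (lookup)
open import Data.Maybe using (Maybe; just; nothing)
open import Data.Product using (_×_; _,_; ∃; Σ)
open import Data.Sum using (_⊎_)
open import Data.List using (List; []; _∷_; _++_; concatMap; map)
open import Data.List.Membership.Propositional using (_∈_)
open import Data.List.Relation.Unary.All using (All)
open import Relation.Nullary using (Dec; yes; no; ¬_; does)
open import Relation.Binary.PropositionalEquality using (_≡_; refl; cong)

-- Comparator networks (positions 0-based: paper position p+1 = Fin p)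

record Comparator (n : ℕ) : Set where
  constructor cmp
  field
    i   : Fin n
    j   : Fin n
    i<j : i Fin.< j

Network : ℕ → Set
Network n = List (Comparator n)

applyC : ∀ {n} → Comparator n → (Fin n → Bool) → (Fin n → Bool)
applyC (cmp i j _) v p =
  if does (p Fin.≟ i) then v i ∨ v j
  else if does (p Fin.≟ j) then v i ∧ v j
  else v p

output : ∀ {n} → Network n → (Fin n → Bool) → (Fin n → Bool)
output []      v = v
output (c ∷ f) v = output f (applyC c v)

_≥B_ : Bool → Bool → Set
a ≥B b = b Bool.≤ a

-- selection network for k (1-based indices: position p has index toℕ p + 1)
IsSelection : ∀ {n} → Network n → ℕ → Set
IsSelection {n} f k = (x : Fin n → Bool) →
  ((p q : Fin n) → toℕ q ≡ suc (toℕ p) → suc (toℕ q) ≤ k →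
     output f x p ≥B output f x q)
  × ((p q : Fin n) → suc (toℕ p) ≤ k → k < suc (toℕ q) →
     output f x p ≥B output f x q)

data Var (n : ℕ) : Set where
  inp : Fin n → Var n
  top : ℕ → Var n            -- output c (upper) of the t-th comparator (0-based)
  bot : ℕ → Var n            -- output d (lower) of the t-th comparator

inp-inj : ∀ {n} {p q : Fin n} → inp p ≡ inp q → p ≡ q
inp-inj refl = refl
top-inj : ∀ {n} {s t : ℕ} → top {n} s ≡ top t → s ≡ t
top-inj refl = refl
bot-inj : ∀ {n} {s t : ℕ} → bot {n} s ≡ bot t → s ≡ t
bot-inj refl = refl

_≟V_ : ∀ {n} (u v : Var n) → Dec (u ≡ v)
inp p ≟V inp q with p Fin.≟ q
... | yes refl = yes refl
... | no ne = no (λ e → ne (inp-inj e))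
inp _ ≟V top _ = no (λ ())
inp _ ≟V bot _ = no (λ ())
top _ ≟V inp _ = no (λ ())
top s ≟V top t with s Data.Nat.≟ t
... | yes refl = yes refl
... | no ne = no (λ e → ne (top-inj e))
top _ ≟V bot _ = no (λ ())
bot _ ≟V inp _ = no (λ ())
bot _ ≟V top _ = no (λ ())
bot s ≟V bot t with s Data.Nat.≟ t
... | yes refl = yes refl
... | no ne = no (λ e → ne (bot-inj e))

record Gate (n : ℕ) : Set where
  constructor gate
  field
    a b c d : Var n

-- current variable at each position after a comparator
step-σ : ∀ {n} → ℕ → Comparator n → (Fin n → Var n) → (Fin n → Var n)
step-σ t (cmp i j _) σ p =
  if does (p Fin.≟ i) then top t
  else if does (p Fin.≟ j) then bot t
  else σ p

gatesFrom : ∀ {n} → ℕ → (Fin n → Var n) → Network n → List (Gate n)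
gatesFrom t σ [] = []
gatesFrom t σ (c@(cmp i j _) ∷ f) =
  gate (σ i) (σ j) (top t) (bot t) ∷ gatesFrom (suc t) (step-σ t c σ) f

finalFrom : ∀ {n} → ℕ → (Fin n → Var n) → Network n → (Fin n → Var n)
finalFrom t σ [] = σ
finalFrom t σ (c ∷ f) = finalFrom (suc t) (step-σ t c σ) f

gates : ∀ {n} → Network n → List (Gate n)
gates f = gatesFrom 0 inp f

-- output variables y_1..y_n (y_{p+1} = outVar f p)
outVar : ∀ {n} → Network n → Fin n → Var n
outVar f = finalFrom 0 inp f

-- literals: (v , true) is v, (v , false) is ¬ v
Lit : ℕ → Set
Lit n = Var n × Bool

Clause : ℕ → Set
Clause n = List (Lit n)

gateClauses : ∀ {n} → Gate n → List (Clause n)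
gateClauses (gate a b c d) =
  ((a , false) ∷ (c , true) ∷ []) ∷
  ((b , false) ∷ (c , true) ∷ []) ∷
  ((a , false) ∷ (b , false) ∷ (d , true) ∷ []) ∷ []

φ : ∀ {n} → Network n → List (Clause n)
φ f = concatMap gateClauses (gates f)

Assignment : ℕ → Set
Assignment n = Var n → Maybe Bool

upd : ∀ {n} → Assignment n → Var n → Bool → Assignment n
upd ρ v b u = if does (u ≟V v) then just b else ρ u

LitFalse : ∀ {n} → Assignment n → Lit n → Set
LitFalse ρ (v , pol) = ρ v ≡ just (not pol)

UPStep : ∀ {n} → Network n → Assignment n → Lit n → Set
UPStep {n} f ρ (v , pol) =
  Σ (Clause n) λ C → C ∈ φ f × Σ (Clause n) λ pre → Σ (Clause n) λ post →
    (C ≡ pre ++ (v , pol) ∷ post) × ρ v ≡ nothing × All (LitFalse ρ) (pre ++ post)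

data UPRun {n} (f : Network n) : Assignment n → List (Lit n) → Assignment n → Set where
  done : ∀ {ρ} → UPRun f ρ [] ρ
  step : ∀ {ρ v pol ls ρ'} → UPStep f ρ (v , pol) →
         UPRun f (upd ρ v pol) ls ρ' → UPRun f ρ ((v , pol) ∷ ls) ρ'

UPDone : ∀ {n} → Network n → Assignment n → Set
UPDone f ρ = ∀ l → ¬ UPStep f ρ l

UPResult : ∀ {n} → Network n → Assignment n → Assignment n → Set
UPResult f ρ₀ ρ = ∃ λ ls → UPRun f ρ₀ ls ρ × UPDone f ρ

Edge : ∀ {n} → Network n → Var n → Var n → Set
Edge f z z' = Σ (Gate _) λ g → g ∈ gates f ×
  (z ≡ Gate.a g ⊎ z ≡ Gate.b g) × (z' ≡ Gate.c g ⊎ z' ≡ Gate.d g)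

data IsPath {n} (f : Network n) : Var n → List (Var n) → Set where
  single : ∀ {z} → IsPath f z []
  cons   : ∀ {z z' zs} → Edge f z z' → IsPath f z' zs → IsPath f z (z' ∷ zs)

lastOf : ∀ {A : Set} → A → List A → A
lastOf z [] = z
lastOf _ (z' ∷ zs) = lastOf z' zs

IsPropagationPath : ∀ {n} → Network n → Assignment n → Fin n → List (Var n) → Set
IsPropagationPath f ρ p zs =
  ρ (inp p) ≡ nothing × IsPath f (inp p) zs ×
  Σ (Assignment _) λ ρ' →
    UPRun f (upd ρ (inp p) true) (map (λ z → (z , true)) zs) ρ' × UPDone f ρ'

initial : ∀ {n} → Subset n → Assignment n
initial s (inp p) = if lookup s p then just true else nothing
initial s (top _) = nothing
initial s (bot _) = nothing

pred-lt : ∀ {k n} → 1 ≤ k → k ≤ n → k ∸ 1 < n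
pred-lt {suc k} _ k≤n = k≤n

module Submission where

-- Unit propagation on the half encoding is sound: every value it assigns agrees with the run of
-- the network on any input containing the inputs set to true. At a fixpoint it is also complete
-- for true outputs, since each comparator clause has fired. With the k − 1 inputs of s a selection
-- network outputs 0 at y_k, so y_k is not yet true; with s ∪ {x}, which has k elements, it outputs
-- 1 at y_k, so propagating x makes y_k true and y_k lies on the propagation path. Output variables
-- feed no comparator, so y_k has no successor and must end the path.

open import Defs
open import Data.Bool as Bool using (Bool; true; false; _∨_; _∧_)
open import Data.Bool.Properties using (≤-maximum; ∨-idem; ∧-idem; ∨-zeroʳ; not-¬; ¬-not)
open import Data.Empty using (⊥-elim)
open import Data.Fin as Fin using (Fin; toℕ; fromℕ<)
open import Data.Fin.Properties using (toℕ-fromℕ<; toℕ-injective; toℕ<n)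
open import Data.Fin.Permutation using (transpose)
import Data.Fin.Permutation.Components as Transposition
open import Data.Fin.Subset using (Subset; ∣_∣; _∪_; ⁅_⁆; _⊆_) renaming (_∈_ to _∈ₛ_; _∉_ to _∉ₛ_)
open import Data.Fin.Subset.Properties
  using (p⊆p∪q; x∈p∪q⁺; x∈p∪q⁻; x∈⁅x⁆; x∈⁅y⁆⇒x≡y; p⊂q⇒∣p∣<∣q∣)
open import Data.List using (List; []; _∷_; _++_)
open import Data.List.Membership.Propositional using (_∈_; find; lose)
open import Data.List.Membership.Propositional.Properties using (∈-concatMap⁺; ∈-concatMap⁻)
open import Data.List.Relation.Unary.All using (All; []; _∷_)
import Data.List.Relation.Unary.All.Properties as All
open import Data.List.Relation.Unary.Any using (Any; here; there)
import Data.List.Relation.Unary.Any.Properties as Any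
open import Data.Maybe using (just; nothing)
open import Data.Maybe.Properties using (just-injective)
open import Data.Nat using (ℕ; zero; suc; _+_; _≤_; _<_; _∸_; z≤n; s≤s)
open import Data.Nat.Properties
  using (+-0-commutativeMonoid; +-suc; +-identityʳ; +-mono-≤; m+[n∸m]≡n; m≤m+n; ≤-trans; ≤-reflexive; <-irrefl;
         m≤n⇒m<n∨m≡n; m<n⇒m<1+n; n<1+n)
open import Algebra.Properties.CommutativeMonoid.Sum +-0-commutativeMonoid using (sum; sum-cong-≗; sum-permute)
open import Data.Product using (_×_; _,_; proj₁; proj₂; uncurry)
open import Data.Sum using (_⊎_; inj₁; inj₂)
open import Data.Unit using (⊤; tt)
open import Data.Vec using (lookup)
import Data.Vec as Vec
open import Data.Vec.Properties using ([]=⇒lookup; lookup⇒[]=)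
open import Function using (_∘_)
open import Relation.Binary.PropositionalEquality
open ≡-Reasoning
open import Relation.Nullary using (yes; no; ¬_; contradiction)

bit : Bool → ℕ
bit true  = 1
bit false = 0

ones : ∀ {n} → (Fin n → Bool) → ℕ
ones w = sum (bit ∘ w)

ones-lookup : ∀ {n} (s : Subset n) → ones (lookup s) ≡ ∣ s ∣
ones-lookup Vec.[]          = refl
ones-lookup (true  Vec.∷ s) = cong suc (ones-lookup s)
ones-lookup (false Vec.∷ s) = ones-lookup s

applyC-ordered : ∀ {n} {i j : Fin n} (i<j : i Fin.< j) (w : Fin n → Bool) →
                 w j Bool.≤ w i → ∀ p → applyC (cmp i j i<j) w p ≡ w p
applyC-ordered {i = i} {j} i<j w wj≤wi p with p Fin.≟ i | p Fin.≟ j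
... | yes refl | _        = max-ordered wj≤wi
  where
  max-ordered : ∀ {a b} → b Bool.≤ a → a ∨ b ≡ a
  max-ordered Bool.b≤b = ∨-idem _
  max-ordered Bool.f≤t = refl
... | no _     | yes refl = min-ordered wj≤wi
  where
  min-ordered : ∀ {a b} → b Bool.≤ a → a ∧ b ≡ b
  min-ordered Bool.b≤b = ∧-idem _
  min-ordered Bool.f≤t = refl
... | no _     | no _     = refl

applyC-inverted : ∀ {n} {i j : Fin n} (i<j : i Fin.< j) (w : Fin n → Bool) →
                  w i ≡ false → w j ≡ true → ∀ p → applyC (cmp i j i<j) w p ≡ w (Transposition.transpose i j p)
applyC-inverted {i = i} {j} i<j w wi wj p with p Fin.≟ i
... | yes refl = cong (_∨ w j) wi
... | no _ with p Fin.≟ j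
...   | yes refl = trans (cong (_∧ w p) wi) (sym wi)
...   | no _     = refl

ordered-or-inverted : ∀ a b → b Bool.≤ a ⊎ (a ≡ false × b ≡ true)
ordered-or-inverted true  b     = inj₁ (≤-maximum b)
ordered-or-inverted false false = inj₁ Bool.b≤b
ordered-or-inverted false true  = inj₂ (refl , refl)

-- On Booleans a comparator either does nothing or swaps its two positions.
ones-applyC : ∀ {n} (c : Comparator n) (w : Fin n → Bool) → ones (applyC c w) ≡ ones w
ones-applyC (cmp i j i<j) w with ordered-or-inverted (w i) (w j)
... | inj₁ wj≤wi     = sum-cong-≗ (cong bit ∘ applyC-ordered i<j w wj≤wi)
... | inj₂ (wi , wj) = begin
  ones (applyC (cmp i j i<j) w)               ≡⟨ sum-cong-≗ (cong bit ∘ applyC-inverted i<j w wi wj) ⟩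
  sum (bit ∘ w ∘ Transposition.transpose i j) ≡⟨ sum-permute (bit ∘ w) (transpose i j) ⟨
  ones w                                      ∎

ones-output : ∀ {n} (f : Network n) (w : Fin n → Bool) → ones (output f w) ≡ ones w
ones-output []      w = refl
ones-output (c ∷ f) w = trans (ones-output f (applyC c w)) (ones-applyC c w)

true-prefix⇒≤ones : ∀ {n} m (w : Fin n → Bool) → m ≤ n → (∀ p → toℕ p < m → w p ≡ true) → m ≤ ones w
true-prefix⇒≤ones zero    w _         _      = z≤n
true-prefix⇒≤ones (suc m) w (s≤s m≤n) prefix rewrite prefix Fin.zero (s≤s z≤n) =
  s≤s (true-prefix⇒≤ones m (w ∘ Fin.suc) m≤n (λ p p<m → prefix (Fin.suc p) (s≤s p<m)))

false-suffix⇒ones≤ : ∀ {n} m (w : Fin n → Bool) → (∀ p → m ≤ toℕ p → w p ≡ false) → ones w ≤ m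
false-suffix⇒ones≤ {zero}  m       w suffix = z≤n
false-suffix⇒ones≤ {suc n} zero    w suffix rewrite suffix Fin.zero z≤n =
  false-suffix⇒ones≤ zero (w ∘ Fin.suc) (λ p _ → suffix (Fin.suc p) z≤n)
false-suffix⇒ones≤ {suc n} (suc m) w suffix =
  +-mono-≤ (bit≤1 (w Fin.zero)) (false-suffix⇒ones≤ m (w ∘ Fin.suc) (λ p m≤p → suffix (Fin.suc p) (s≤s m≤p)))
  where
  bit≤1 : ∀ b → bit b ≤ 1
  bit≤1 true  = s≤s z≤n
  bit≤1 false = z≤n

≤-true : ∀ {a b} → b Bool.≤ a → b ≡ true → a ≡ true
≤-true Bool.b≤b b≡true = b≡true

≤-false : ∀ {a b} → b Bool.≤ a → a ≡ false → b ≡ false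
≤-false Bool.b≤b a≡false = a≡false

descending-prefix-true : ∀ {n k} (o : Fin n → Bool) →
  (∀ p q → toℕ q ≡ suc (toℕ p) → suc (toℕ q) ≤ k → o p ≥B o q) →
  ∀ q → suc (toℕ q) ≤ k → o q ≡ true → ∀ p → toℕ p ≤ toℕ q → o p ≡ true
descending-prefix-true {n} {k} o descending q q<k oq p p≤q = go (toℕ q ∸ toℕ p) p (m+[n∸m]≡n p≤q)
  where
  go : ∀ d p → toℕ p + d ≡ toℕ q → o p ≡ true
  go zero    p p+0≡q = subst (λ r → o r ≡ true) (toℕ-injective (trans (sym p+0≡q) (+-identityʳ _))) oq
  go (suc d) p p+d≡q = ≤-true (descending p p′ (toℕ-fromℕ< p′<n) p′<k) (go d p′ p′+d≡q)
    where
    1+p+d≡q : suc (toℕ p + d) ≡ toℕ q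
    1+p+d≡q = trans (sym (+-suc (toℕ p) d)) p+d≡q
    p<q : suc (toℕ p) ≤ toℕ q
    p<q = subst (suc (toℕ p) ≤_) 1+p+d≡q (m≤m+n (suc (toℕ p)) d)
    p′<n : suc (toℕ p) < n
    p′<n = ≤-trans (s≤s p<q) (toℕ<n q)
    p′ : Fin n
    p′ = fromℕ< p′<n
    p′<k : suc (toℕ p′) ≤ k
    p′<k = ≤-trans (s≤s (subst (_≤ toℕ q) (sym (toℕ-fromℕ< p′<n)) p<q)) q<k
    p′+d≡q : toℕ p′ + d ≡ toℕ q
    p′+d≡q = trans (cong (_+ d) (toℕ-fromℕ< p′<n)) 1+p+d≡q

selection-kth-false : ∀ {n K} (f : Network n) (K<n : K < n) → IsSelection f (suc K) →
  ∀ w → ones w ≤ K → output f w (fromℕ< K<n) ≡ false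
selection-kth-false {K = K} f K<n selection w ones≤K = ¬-not kth≢true
  where
  o = output f w
  K≡pK : K ≡ toℕ (fromℕ< K<n)
  K≡pK = sym (toℕ-fromℕ< K<n)
  kth≢true : o (fromℕ< K<n) ≢ true
  kth≢true oK = <-irrefl refl (≤-trans (true-prefix⇒≤ones (suc K) o K<n prefix)
                                        (subst (_≤ K) (sym (ones-output f w)) ones≤K))
    where
    prefix : ∀ p → toℕ p < suc K → o p ≡ true
    prefix p (s≤s p≤K) = descending-prefix-true o (proj₁ (selection w)) (fromℕ< K<n)
      (s≤s (≤-reflexive (sym K≡pK))) oK p (subst (toℕ p ≤_) K≡pK p≤K)

selection-kth-true : ∀ {n K} (f : Network n) (K<n : K < n) → IsSelection f (suc K) →
  ∀ w → suc K ≤ ones w → output f w (fromℕ< K<n) ≡ true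
selection-kth-true {K = K} f K<n selection w K<ones = ¬-not kth≢false
  where
  o = output f w
  pK = fromℕ< K<n
  kth≢false : o pK ≢ false
  kth≢false oK = <-irrefl refl (≤-trans (subst (suc K ≤_) (sym (ones-output f w)) K<ones)
                                        (false-suffix⇒ones≤ K o suffix))
    where
    suffix : ∀ q → K ≤ toℕ q → o q ≡ false
    suffix q K≤q with m≤n⇒m<n∨m≡n K≤q
    ... | inj₁ K<q = ≤-false (proj₂ (selection w) pK q (s≤s (≤-reflexive (toℕ-fromℕ< K<n))) (s≤s K<q)) oK
    ... | inj₂ K≡q = subst (λ r → o r ≡ false) (toℕ-injective (trans (toℕ-fromℕ< K<n) K≡q)) oK

-- Comparators are counted from the head of the network; beyond its end the values are junk.
gateValues : ∀ {n} → (Fin n → Bool) → Network n → ℕ → Bool × Bool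
gateValues w []              s       = false , false
gateValues w (cmp i j _ ∷ f) zero    = w i ∨ w j , w i ∧ w j
gateValues w (c ∷ f)         (suc s) = gateValues (applyC c w) f s

-- The satisfying assignment of φ(f) that records the run of f on input w.
valuation : ∀ {n} → (Fin n → Bool) → Network n → Var n → Bool
valuation w f (inp p) = w p
valuation w f (top s) = proj₁ (gateValues w f s)
valuation w f (bot s) = proj₂ (gateValues w f s)

outputPair : ∀ {n} → (Var n → Bool) → ℕ → Bool × Bool
outputPair V s = V (top s) , V (bot s)

-- V agrees with the run of the rest f of a network whose first t comparators have turned the
-- position variables into σ and the values into w.
record Tracks {n} (V : Var n → Bool) (t : ℕ) (σ : Fin n → Var n) (w : Fin n → Bool) (f : Network n) : Set where
  field
    at-positions : ∀ p → V (σ p) ≡ w p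
    at-gates     : ∀ s → outputPair V (t + s) ≡ gateValues w f s
open Tracks

valuation-tracks : ∀ {n} (w : Fin n → Bool) (f : Network n) → Tracks (valuation w f) 0 inp w f
valuation-tracks w f = record { at-positions = λ p → refl ; at-gates = λ s → refl }

GateHolds : ∀ {n} → (Var n → Bool) → Gate n → Set
GateHolds V (gate a b c d) = (V c ≡ V a ∨ V b) × (V d ≡ V a ∧ V b)

module _ {n} {V : Var n → Bool} {t σ w} {i j : Fin n} {i<j : i Fin.< j} {f : Network n}
         (tracks : Tracks V t σ w (cmp i j i<j ∷ f)) where

  tracks-gate-outputs : outputPair V t ≡ (w i ∨ w j , w i ∧ w j)
  tracks-gate-outputs = trans (cong (outputPair V) (sym (+-identityʳ t))) (at-gates tracks 0)

  tracks-gate : GateHolds V (gate (σ i) (σ j) (top t) (bot t))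
  tracks-gate rewrite at-positions tracks i | at-positions tracks j =
    cong proj₁ tracks-gate-outputs , cong proj₂ tracks-gate-outputs

  tracks-step : Tracks V (suc t) (step-σ t (cmp i j i<j) σ) (applyC (cmp i j i<j) w) f
  tracks-step = record { at-positions = positions ; at-gates = later-gates }
    where
    positions : ∀ p → V (step-σ t (cmp i j i<j) σ p) ≡ applyC (cmp i j i<j) w p
    positions p with p Fin.≟ i
    ... | yes _ = cong proj₁ tracks-gate-outputs
    ... | no _ with p Fin.≟ j
    ...   | yes _ = cong proj₂ tracks-gate-outputs
    ...   | no _  = at-positions tracks p
    later-gates : ∀ s → outputPair V (suc t + s) ≡ gateValues (applyC (cmp i j i<j) w) f s
    later-gates s = trans (cong (outputPair V) (sym (+-suc t s))) (at-gates tracks (suc s))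

tracks-gates : ∀ {n} {V : Var n → Bool} {t σ w} (f : Network n) → Tracks V t σ w f →
               ∀ {g} → g ∈ gatesFrom t σ f → GateHolds V g
tracks-gates (cmp i j i<j ∷ f) tracks (here refl) = tracks-gate tracks
tracks-gates (cmp i j i<j ∷ f) tracks (there g∈) = tracks-gates f (tracks-step tracks) g∈

tracks-final : ∀ {n} {V : Var n → Bool} {t σ w} (f : Network n) → Tracks V t σ w f →
               ∀ p → V (finalFrom t σ f p) ≡ output f w p
tracks-final []                tracks = at-positions tracks
tracks-final (cmp i j i<j ∷ f) tracks = tracks-final f (tracks-step tracks)

Satisfies : ∀ {n} → (Var n → Bool) → Clause n → Set
Satisfies V C = Any (λ l → V (proj₁ l) ≡ proj₂ l) C

record Models {n} (V : Var n → Bool) (f : Network n) : Set where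
  field
    satisfies : ∀ {C} → C ∈ φ f → Satisfies V C
open Models

gateClauses-satisfied : ∀ {n} {V : Var n → Bool} (g : Gate n) → GateHolds V g →
                        ∀ {C} → C ∈ gateClauses g → Satisfies V C
gateClauses-satisfied {V = V} (gate a b c d) (c≡a∨b , d≡a∧b) (here refl) with V a in Va
... | false = here Va
... | true  = there (here c≡a∨b)
gateClauses-satisfied {V = V} (gate a b c d) (c≡a∨b , d≡a∧b) (there (here refl)) with V b in Vb
... | false = here Vb
... | true  = there (here (trans c≡a∨b (∨-zeroʳ (V a))))
gateClauses-satisfied {V = V} (gate a b c d) (c≡a∨b , d≡a∧b) (there (there (here refl)))
  with V a in Va | V b in Vb
... | false | _     = here Va
... | true  | false = there (here Vb)
... | true  | true  = there (there (here d≡a∧b))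

valuation-models : ∀ {n} (w : Fin n → Bool) (f : Network n) → Models (valuation w f) f
satisfies (valuation-models w f) C∈φ with find (∈-concatMap⁻ gateClauses {xs = gates f} C∈φ)
... | g , g∈ , C∈g = gateClauses-satisfied g (tracks-gates f (valuation-tracks w f) g∈) C∈g

record Consistent {n} (V : Var n → Bool) (ρ : Assignment n) : Set where
  field
    agrees : ∀ {u b} → ρ u ≡ just b → V u ≡ b
open Consistent

consistent-output : ∀ {n} {f : Network n} {w ρ p b} → Consistent (valuation w f) ρ →
                    ρ (outVar f p) ≡ just b → output f w p ≡ b
consistent-output {f = f} {w} {p = p} consistent ρy =
  trans (sym (tracks-final f (valuation-tracks w f) p)) (agrees consistent ρy)

falsified-unsatisfied : ∀ {n} {V : Var n → Bool} {ρ} → Consistent V ρ →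
                        ∀ {C} → All (LitFalse ρ) C → ¬ Satisfies V C
falsified-unsatisfied consistent {(u , pol) ∷ _} (ρu≡¬pol ∷ _) (here Vu≡pol) =
  not-¬ Vu≡pol (agrees consistent ρu≡¬pol)
falsified-unsatisfied consistent (_ ∷ rest) (there satisfied) = falsified-unsatisfied consistent rest satisfied

unit-literal-forced : ∀ {n} {V : Var n → Bool} {ρ} → Consistent V ρ → ∀ pre {v pol} post →
  Satisfies V (pre ++ (v , pol) ∷ post) → All (LitFalse ρ) (pre ++ post) → V v ≡ pol
unit-literal-forced consistent pre post satisfied others-false with Any.++⁻ pre satisfied
... | inj₁ in-pre          = ⊥-elim (falsified-unsatisfied consistent (All.++⁻ˡ pre others-false) in-pre)
... | inj₂ (here Vv≡pol)   = Vv≡pol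
... | inj₂ (there in-post) = ⊥-elim (falsified-unsatisfied consistent (All.++⁻ʳ pre others-false) in-post)

upd-consistent : ∀ {n} {V : Var n → Bool} {ρ v b} → Consistent V ρ → V v ≡ b → Consistent V (upd ρ v b)
agrees (upd-consistent {v = v} consistent Vv≡b) {u} updated with u ≟V v
... | yes refl = trans Vv≡b (just-injective updated)
... | no _     = agrees consistent updated

upd-hit : ∀ {n} (ρ : Assignment n) v b → upd ρ v b v ≡ just b
upd-hit ρ v b with v ≟V v
... | yes _  = refl
... | no v≢v = ⊥-elim (v≢v refl)

upd-keeps : ∀ {n} {ρ : Assignment n} {v pol u b} → ρ v ≡ nothing → ρ u ≡ just b → upd ρ v pol u ≡ just b
upd-keeps {v = v} {u = u} ρv≡nothing ρu≡just with u ≟V v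
... | yes refl = contradiction (trans (sym ρv≡nothing) ρu≡just) λ ()
... | no _     = ρu≡just

upd-origin : ∀ {n} {ρ : Assignment n} {v pol u b} → upd ρ v pol u ≡ just b → u ≡ v ⊎ ρ u ≡ just b
upd-origin {v = v} {u = u} updated with u ≟V v
... | yes u≡v = inj₁ u≡v
... | no _    = inj₂ updated

unit-step-sound : ∀ {n} {V : Var n → Bool} {f ρ v pol} → Models V f → Consistent V ρ →
                  UPStep f ρ (v , pol) → V v ≡ pol
unit-step-sound models consistent (_ , C∈φ , pre , post , refl , _ , others-false) =
  unit-literal-forced consistent pre post (satisfies models C∈φ) others-false

run-consistent : ∀ {n} {V : Var n → Bool} {f ρ ls ρ′} → Models V f → Consistent V ρ →
                 UPRun f ρ ls ρ′ → Consistent V ρ′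
run-consistent models consistent done            = consistent
run-consistent models consistent (step unit run) =
  run-consistent models (upd-consistent consistent (unit-step-sound models consistent unit)) run

run-keeps : ∀ {n} {f : Network n} {ρ ls ρ′ u b} → UPRun f ρ ls ρ′ → ρ u ≡ just b → ρ′ u ≡ just b
run-keeps done ρu = ρu
run-keeps {u = u} (step {ρ} {v} {pol} (_ , _ , _ , _ , _ , ρv≡nothing , _) run) ρu =
  run-keeps run (upd-keeps {ρ = ρ} {v} {pol} {u} ρv≡nothing ρu)

run-origin : ∀ {n} {f : Network n} {ρ ls ρ′ u b} → UPRun f ρ ls ρ′ → ρ′ u ≡ just b →
             ρ u ≡ just b ⊎ Any ((u ≡_) ∘ proj₁) ls
run-origin done ρ′u = inj₁ ρ′u
run-origin {u = u} (step {ρ} {v} {pol} _ run) ρ′u with run-origin run ρ′u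
... | inj₂ later = inj₂ (there later)
... | inj₁ ρ₁u with upd-origin {ρ = ρ} {v} {pol} {u} ρ₁u
...   | inj₁ u≡v = inj₂ (here u≡v)
...   | inj₂ ρu  = inj₁ ρu

fixpoint-forces : ∀ {n} {V : Var n → Bool} {f ρ} → Models V f → Consistent V ρ → UPDone f ρ →
  ∀ pre {v pol} post → (pre ++ (v , pol) ∷ post) ∈ φ f → All (LitFalse ρ) (pre ++ post) → ρ v ≡ just pol
fixpoint-forces {ρ = ρ} models consistent at-fixpoint pre {v} post C∈φ others-false with ρ v in ρv
... | nothing = ⊥-elim (at-fixpoint _ (_ , C∈φ , pre , post , refl , ρv , others-false))
... | just b  = cong just (trans (sym (agrees consistent ρv))
                                 (unit-literal-forced consistent pre post (satisfies models C∈φ) others-false))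

GateClosed : ∀ {n} → Assignment n → Gate n → Set
GateClosed ρ (gate a b c d) =
  (ρ a ≡ just true → ρ c ≡ just true) × (ρ b ≡ just true → ρ c ≡ just true) ×
  (ρ a ≡ just true → ρ b ≡ just true → ρ d ≡ just true)

fixpoint-gates-closed : ∀ {n} {V : Var n → Bool} {f ρ} → Models V f → Consistent V ρ → UPDone f ρ →
                        ∀ {g} → g ∈ gates f → GateClosed ρ g
fixpoint-gates-closed {ρ = ρ} models consistent at-fixpoint {gate a b c d} g∈ =
  (λ ρa → forced ((a , false) ∷ []) [] (here refl) (ρa ∷ [])) ,
  (λ ρb → forced ((b , false) ∷ []) [] (there (here refl)) (ρb ∷ [])) ,
  (λ ρa ρb → forced ((a , false) ∷ (b , false) ∷ []) [] (there (there (here refl))) (ρa ∷ ρb ∷ []))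
  where
  forced : ∀ pre {v pol} post → (pre ++ (v , pol) ∷ post) ∈ gateClauses (gate a b c d) →
           All (LitFalse ρ) (pre ++ post) → ρ v ≡ just pol
  forced pre post C∈g =
    fixpoint-forces models consistent at-fixpoint pre post (∈-concatMap⁺ gateClauses (lose g∈ C∈g))

∨-true⁻ : ∀ a b → a ∨ b ≡ true → a ≡ true ⊎ b ≡ true
∨-true⁻ true  b _    = inj₁ refl
∨-true⁻ false b b≡t = inj₂ b≡t

∧-true⁻ : ∀ a b → a ∧ b ≡ true → a ≡ true × b ≡ true
∧-true⁻ true true _ = refl , refl

closed-propagates : ∀ {n} {ρ : Assignment n} (f : Network n) {t σ w} →
  (∀ {g} → g ∈ gatesFrom t σ f → GateClosed ρ g) →
  (∀ p → w p ≡ true → ρ (σ p) ≡ just true) →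
  ∀ p → output f w p ≡ true → ρ (finalFrom t σ f p) ≡ just true
closed-propagates []                closed inputs = inputs
closed-propagates {ρ = ρ} (cmp i j i<j ∷ f) {t} {σ} {w} closed inputs =
  closed-propagates f (closed ∘ there) step-inputs
  where
  step-inputs : ∀ p → applyC (cmp i j i<j) w p ≡ true → ρ (step-σ t (cmp i j i<j) σ p) ≡ just true
  step-inputs p max-or-min with closed (here refl) | p Fin.≟ i
  ... | via-a , via-b , _ | yes _ with ∨-true⁻ (w i) (w j) max-or-min
  ...   | inj₁ wi = via-a (inputs i wi)
  ...   | inj₂ wj = via-b (inputs j wj)
  step-inputs p max-or-min | _ , _ , via-ab | no _ with p Fin.≟ j
  ...   | yes _ = uncurry (λ wi wj → via-ab (inputs i wi) (inputs j wj)) (∧-true⁻ (w i) (w j) max-or-min)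
  ...   | no _  = inputs p max-or-min

fixpoint-outputs-true : ∀ {n} (f : Network n) {w ρ} → Consistent (valuation w f) ρ → UPDone f ρ →
  (∀ p → w p ≡ true → ρ (inp p) ≡ just true) → ∀ p → output f w p ≡ true → ρ (outVar f p) ≡ just true
fixpoint-outputs-true f {w} consistent at-fixpoint =
  closed-propagates f (fixpoint-gates-closed (valuation-models w f) consistent at-fixpoint)

initial-inputs : ∀ {n} (s : Subset n) {p} → p ∈ₛ s → initial s (inp p) ≡ just true
initial-inputs s p∈s = cong (λ b → Bool.if b then just true else nothing) ([]=⇒lookup p∈s)

initial-consistent : ∀ {n} {s t : Subset n} {f : Network n} → s ⊆ t →
                     Consistent (valuation (lookup t) f) (initial s)
agrees (initial-consistent {s = s} s⊆t) {inp p} ρp with lookup s p in sp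
agrees (initial-consistent {s = s} s⊆t) {inp p} ρp | true =
  trans ([]=⇒lookup (s⊆t (lookup⇒[]= p s sp))) (just-injective ρp)
agrees (initial-consistent s⊆t) {inp p} () | false
agrees (initial-consistent s⊆t) {top _} ()
agrees (initial-consistent s⊆t) {bot _} ()

CreatedBefore : ∀ {n} → ℕ → Var n → Set
CreatedBefore t (inp _) = ⊤
CreatedBefore t (top s) = s < t
CreatedBefore t (bot s) = s < t

created-before-suc : ∀ {n t} (u : Var n) → CreatedBefore t u → CreatedBefore (suc t) u
created-before-suc (inp _) _   = tt
created-before-suc (top _) s<t = m<n⇒m<1+n s<t
created-before-suc (bot _) s<t = m<n⇒m<1+n s<t

top-fresh : ∀ {n t} (u : Var n) → CreatedBefore t u → top t ≢ u
top-fresh _ t<t refl = <-irrefl refl t<t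

bot-fresh : ∀ {n t} (u : Var n) → CreatedBefore t u → bot t ≢ u
bot-fresh _ t<t refl = <-irrefl refl t<t

step-σ-cases : ∀ {n} t {i j : Fin n} (i<j : i Fin.< j) σ p →
  (p ≡ i × step-σ t (cmp i j i<j) σ p ≡ top t) ⊎
  (p ≡ j × step-σ t (cmp i j i<j) σ p ≡ bot t) ⊎
  (p ≢ i × p ≢ j × step-σ t (cmp i j i<j) σ p ≡ σ p)
step-σ-cases t {i} {j} i<j σ p with p Fin.≟ i
... | yes p≡i = inj₁ (p≡i , refl)
... | no p≢i with p Fin.≟ j
...   | yes p≡j = inj₂ (inj₁ (p≡j , refl))
...   | no p≢j  = inj₂ (inj₂ (p≢i , p≢j , refl))

finalFrom-created-before : ∀ {n} (f : Network n) {t σ p} u → CreatedBefore t u →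
                           finalFrom t σ f p ≡ u → σ p ≡ u
finalFrom-created-before [] u _ final≡u = final≡u
finalFrom-created-before (cmp i j i<j ∷ f) {t} {σ} {p} u old final≡u
  with step-σ-cases t i<j σ p | finalFrom-created-before f u (created-before-suc u old) final≡u
... | inj₁ (_ , is-top)               | step≡u = ⊥-elim (top-fresh u old (trans (sym is-top) step≡u))
... | inj₂ (inj₁ (_ , is-bot))        | step≡u = ⊥-elim (bot-fresh u old (trans (sym is-bot) step≡u))
... | inj₂ (inj₂ (_ , _ , unchanged)) | step≡u = trans (sym unchanged) step≡u

record WellFormed {n} (t : ℕ) (σ : Fin n → Var n) : Set where
  field
    injective : ∀ {p q} → σ p ≡ σ q → p ≡ q
    created   : ∀ p → CreatedBefore t (σ p)
open WellFormed

inp-wellFormed : ∀ {n} → WellFormed {n} 0 inp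
inp-wellFormed = record { injective = inp-inj ; created = λ _ → tt }

wellFormed-step : ∀ {n t σ} {i j : Fin n} (i<j : i Fin.< j) → WellFormed t σ →
                  WellFormed (suc t) (step-σ t (cmp i j i<j) σ)
wellFormed-step {t = t} {σ} i<j wf = record { injective = injective′ ; created = created′ }
  where
  created′ : ∀ p → CreatedBefore (suc t) (step-σ t (cmp _ _ i<j) σ p)
  created′ p with step-σ-cases t i<j σ p
  ... | inj₁ (_ , is-top)               rewrite is-top    = n<1+n t
  ... | inj₂ (inj₁ (_ , is-bot))        rewrite is-bot    = n<1+n t
  ... | inj₂ (inj₂ (_ , _ , unchanged)) rewrite unchanged = created-before-suc (σ p) (created wf p)
  top≢bot : top {n = _} t ≢ bot t
  top≢bot ()
  injective′ : ∀ {p q} → step-σ t (cmp _ _ i<j) σ p ≡ step-σ t (cmp _ _ i<j) σ q → p ≡ q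
  injective′ {p} {q} same with step-σ-cases t i<j σ p | step-σ-cases t i<j σ q
  ... | inj₁ (p≡i , _)          | inj₁ (q≡i , _)          = trans p≡i (sym q≡i)
  ... | inj₁ (_ , sp)           | inj₂ (inj₁ (_ , sq))    = ⊥-elim (top≢bot (trans (sym sp) (trans same sq)))
  ... | inj₁ (_ , sp)           | inj₂ (inj₂ (_ , _ , sq)) =
    ⊥-elim (top-fresh (σ q) (created wf q) (trans (sym sp) (trans same sq)))
  ... | inj₂ (inj₁ (_ , sp))    | inj₁ (_ , sq)           = ⊥-elim (top≢bot (trans (sym sq) (trans (sym same) sp)))
  ... | inj₂ (inj₁ (p≡j , _))   | inj₂ (inj₁ (q≡j , _))   = trans p≡j (sym q≡j)
  ... | inj₂ (inj₁ (_ , sp))    | inj₂ (inj₂ (_ , _ , sq)) =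
    ⊥-elim (bot-fresh (σ q) (created wf q) (trans (sym sp) (trans same sq)))
  ... | inj₂ (inj₂ (_ , _ , sp)) | inj₁ (_ , sq)           =
    ⊥-elim (top-fresh (σ p) (created wf p) (trans (sym sq) (trans (sym same) sp)))
  ... | inj₂ (inj₂ (_ , _ , sp)) | inj₂ (inj₁ (_ , sq))    =
    ⊥-elim (bot-fresh (σ p) (created wf p) (trans (sym sq) (trans (sym same) sp)))
  ... | inj₂ (inj₂ (_ , _ , sp)) | inj₂ (inj₂ (_ , _ , sq)) = injective wf (trans (sym sp) (trans same sq))

final-not-gate-input : ∀ {n} (f : Network n) {t σ} → WellFormed t σ →
  ∀ {g} → g ∈ gatesFrom t σ f → ∀ p → finalFrom t σ f p ≢ Gate.a g × finalFrom t σ f p ≢ Gate.b g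
final-not-gate-input (cmp i j i<j ∷ f) {t} {σ} wf (here refl) p =
  consumed i (λ p≢i _ → p≢i) , consumed j (λ _ p≢j → p≢j)
  where
  consumed : ∀ r → (p ≢ i → p ≢ j → p ≢ r) → finalFrom (suc t) (step-σ t (cmp i j i<j) σ) f p ≢ σ r
  consumed r untouched final≡σr
    with step-σ-cases t i<j σ p
       | finalFrom-created-before f (σ r) (created-before-suc (σ r) (created wf r)) final≡σr
  ... | inj₁ (_ , is-top)                   | step≡σr = top-fresh (σ r) (created wf r) (trans (sym is-top) step≡σr)
  ... | inj₂ (inj₁ (_ , is-bot))            | step≡σr = bot-fresh (σ r) (created wf r) (trans (sym is-bot) step≡σr)
  ... | inj₂ (inj₂ (p≢i , p≢j , unchanged)) | step≡σr =
    untouched p≢i p≢j (injective wf (trans (sym unchanged) step≡σr))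
final-not-gate-input (cmp i j i<j ∷ f) wf (there g∈) = final-not-gate-input f (wellFormed-step i<j wf) g∈

outVar-no-successor : ∀ {n} (f : Network n) p z → ¬ Edge f (outVar f p) z
outVar-no-successor f p z (g , g∈ , inj₁ y≡a , _) = proj₁ (final-not-gate-input f inp-wellFormed g∈ p) y≡a
outVar-no-successor f p z (g , g∈ , inj₂ y≡b , _) = proj₂ (final-not-gate-input f inp-wellFormed g∈ p) y≡b

path-sink-last : ∀ {n} {f : Network n} {z zs u} → IsPath f z zs → u ∈ z ∷ zs →
                 (∀ z′ → ¬ Edge f u z′) → lastOf z zs ≡ u
path-sink-last single           (here refl)  sink = refl
path-sink-last (cons edge path) (here refl)  sink = ⊥-elim (sink _ edge)
path-sink-last (cons edge path) (there u∈zs) sink = path-sink-last path u∈zs sink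

kth-output-unset : ∀ {n K} (f : Network n) (K<n : K < n) → IsSelection f (suc K) →
  ∀ (s : Subset n) → ∣ s ∣ ≡ K → ∀ {ls ρ} → UPRun f (initial s) ls ρ →
  ρ (outVar f (fromℕ< K<n)) ≢ just true
kth-output-unset f K<n selection s ∣s∣≡K run ρy = contradiction (begin
  true                             ≡⟨ consistent-output consistent ρy ⟨
  output f (lookup s) (fromℕ< K<n) ≡⟨ selection-kth-false f K<n selection (lookup s) ones≤K ⟩
  false                            ∎) λ ()
  where
  consistent = run-consistent (valuation-models (lookup s) f) (initial-consistent (λ p∈s → p∈s)) run
  ones≤K = ≤-reflexive (trans (ones-lookup s) ∣s∣≡K)

kth-output-set : ∀ {n K} (f : Network n) (K<n : K < n) → IsSelection f (suc K) →
  ∀ (s : Subset n) → ∣ s ∣ ≡ K → ∀ {ls ρ} → UPRun f (initial s) ls ρ →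
  ∀ x → ρ (inp x) ≡ nothing → ∀ {ls′ ρ′} → UPRun f (upd ρ (inp x) true) ls′ ρ′ → UPDone f ρ′ →
  ρ′ (outVar f (fromℕ< K<n)) ≡ just true
kth-output-set {K = K} f K<n selection s ∣s∣≡K {ρ = ρ} run x ρx≡nothing {ρ′ = ρ′} run′ at-fixpoint =
  fixpoint-outputs-true f consistent′ at-fixpoint s′-inputs (fromℕ< K<n)
    (selection-kth-true f K<n selection (lookup s′) K<ones)
  where
  s′ = s ∪ ⁅ x ⁆
  x∈s′ : x ∈ₛ s′
  x∈s′ = x∈p∪q⁺ (inj₂ (x∈⁅x⁆ x))
  x∉s : x ∉ₛ s
  x∉s x∈s = contradiction (trans (sym ρx≡nothing) (run-keeps run (initial-inputs s x∈s))) λ ()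
  K<ones : suc K ≤ ones (lookup s′)
  K<ones = subst₂ _≤_ (cong suc ∣s∣≡K) (sym (ones-lookup s′))
                     (p⊂q⇒∣p∣<∣q∣ (p⊆p∪q _ , x , x∈s′ , x∉s))
  models′ = valuation-models (lookup s′) f
  consistent′ : Consistent (valuation (lookup s′) f) ρ′
  consistent′ = run-consistent models′
    (upd-consistent (run-consistent models′ (initial-consistent (p⊆p∪q _)) run) ([]=⇒lookup x∈s′)) run′
  s′-inputs : ∀ p → lookup s′ p ≡ true → ρ′ (inp p) ≡ just true
  s′-inputs p s′p with x∈p∪q⁻ s ⁅ x ⁆ (lookup⇒[]= p s′ s′p)
  ... | inj₁ p∈s   = run-keeps run′ (upd-keeps {ρ = ρ} ρx≡nothing (run-keeps run (initial-inputs s p∈s)))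
  ... | inj₂ p∈⁅x⁆ rewrite x∈⁅y⁆⇒x≡y x p∈⁅x⁆ = run-keeps run′ (upd-hit ρ (inp x) true)

lemma12 : (n k : ℕ) (f : Network n) (1≤k : 1 ≤ k) (k≤n : k ≤ n) →
    IsSelection f k →
    (s : Subset n) → ∣ s ∣ ≡ k ∸ 1 →
    (ρ : Assignment n) → UPResult f (initial s) ρ →
    (x : Fin n) (zs : List (Var n)) → IsPropagationPath f ρ x zs →
    lastOf (inp x) zs ≡ outVar f (fromℕ< {k ∸ 1} {n} (pred-lt 1≤k k≤n))
lemma12 n (suc K) f (s≤s z≤n) K<n selection s ∣s∣≡K ρ (_ , run , _) x zs
        (ρx≡nothing , path , ρ′ , run′ , at-fixpoint) =
  path-sink-last path yK∈path (outVar-no-successor f (fromℕ< K<n))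
  where
  yK∈path : outVar f (fromℕ< K<n) ∈ inp x ∷ zs
  yK∈path with run-origin run′ (kth-output-set f K<n selection s ∣s∣≡K run x ρx≡nothing run′ at-fixpoint)
  ... | inj₂ set-by-propagation = there (Any.map⁻ set-by-propagation)
  ... | inj₁ set-before with upd-origin {ρ = ρ} set-before
  ...   | inj₁ yK≡x = here yK≡x
  ...   | inj₂ ρyK  = ⊥-elim (kth-output-unset f K<n selection s ∣s∣≡K run ρyK)
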